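{- Let $K$ be a field. Then $\widetilde{K}$ is a subfield of $K$.
   Context: For a field $K$ and $r\in K$, a finite set $A$ with $\{r\}\subseteq A\subseteq K$ is called adequate for $r$ if every mapping $f:A\to K$ satisfying (i) if $1\in A$ then $f(1)=1$; (ii) if $a,b\in A$ and $a+b\in A$ then $f(a+b)=f(a)+f(b)$; (iii) if $a,b\in A$ and $a\cdot b\in A$ then $f(a\cdot b)=f(a)\cdot f(b)$, also satisfies $f(r)=r$. $\widetilde{K}$ denotes the set of all $r\in K$ for which there exists a finite set adequate for $r$. -}

module Defs where

open import Level using (Level; _⊔_; suc)
open import Algebra.Bundles using (CommutativeRing)
open import Data.List using (List; length; lookup)
open import Data.Fin using (Fin)
open import Data.Product using (Σ; ∃; _×_)
open import Relation.Nullary using (¬_)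

record Field (c ℓ : Level) : Set (suc (c ⊔ ℓ)) where
  field
    commutativeRing : CommutativeRing c ℓ
  open CommutativeRing commutativeRing public
  field
    1≉0     : ¬ (1# ≈ 0#)
    inverse : ∀ x → ¬ (x ≈ 0#) → ∃ λ y → x * y ≈ 1#

module _ {c ℓ : Level} (K : Field c ℓ) where
  open Field K

  -- A finite subset A of K is given as a list; a mapping f : A → K is
  -- given by its values on the positions of the list, required to be
  -- well defined (equal elements of A get equal values).
  Map : List Carrier → Set (c ⊔ ℓ)
  Map A = Σ (Fin (length A) → Carrier) λ f →
            ∀ i j → lookup A i ≈ lookup A j → f i ≈ f j

  Admissible : (A : List Carrier) → (Fin (length A) → Carrier) → Set ℓ
  Admissible A f =
    (∀ i → lookup A i ≈ 1# → f i ≈ 1#) ×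
    (∀ i j k → lookup A i + lookup A j ≈ lookup A k → f k ≈ f i + f j) ×
    (∀ i j k → lookup A i * lookup A j ≈ lookup A k → f k ≈ f i * f j)

  Adequate : Carrier → List Carrier → Set (c ⊔ ℓ)
  Adequate r A =
    (∃ λ (i : Fin (length A)) → lookup A i ≈ r) ×
    (∀ (m : Map A) → Admissible A (Σ.proj₁ m) →
       ∀ i → lookup A i ≈ r → Σ.proj₁ m i ≈ r)

  InKtilde : Carrier → Set (c ⊔ ℓ)
  InKtilde r = ∃ λ (A : List Carrier) → Adequate r A

  record IsSubfield {p} (S : Carrier → Set p) : Set (c ⊔ ℓ ⊔ p) where
    field
      resp   : ∀ {x y} → x ≈ y → S x → S y
      has-0  : S 0#
      has-1  : S 1#
      +-closed : ∀ {x y} → S x → S y → S (x + y)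
      neg-closed : ∀ {x} → S x → S (- x)
      *-closed : ∀ {x y} → S x → S y → S (x * y)
      inv-closed : ∀ {x} → S x → ¬ (x ≈ 0#) →
                   ∃ λ y → (x * y ≈ 1#) × S y

{-# OPTIONS --safe #-}
module Submission where

-- Restricting an admissible map to a sublist keeps it admissible, so any list
-- containing a list adequate for r is again adequate for r. If A and B are
-- adequate for x and y, every admissible f on x + y ∷ A ++ B thus fixes x and y,
-- hence x + y by additivity; likewise for x * y. For - x, adjoin 0 (fixed, being
-- the only z with z + z = z) and solve x + f(- x) = f(0) = 0; for x⁻¹, adjoin 1
-- and solve x · f(x⁻¹) = 1, which needs x ≠ 0.

open import Defs
open import Level using (Level)
open import Algebra.Definitions using (AlmostLeftCancellative)
open import Data.List using (List; []; _∷_; length; lookup; _++_)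
open import Data.List.Relation.Unary.Any using (here; there; index)
open import Data.List.Relation.Unary.Any.Properties using (lookup-index)
open import Data.Fin using (Fin)
open import Data.Product using (∃; _×_; _,_; proj₁; proj₂)
open import Function using (_∘_)
open import Relation.Nullary using (¬_)
import Algebra.Properties.Monoid as MonoidProperties
import Algebra.Properties.Ring as RingProperties
import Data.List.Membership.Setoid as Membership
import Data.List.Membership.Setoid.Properties as Membershipₚ
import Data.List.Relation.Binary.Subset.Setoid as Subset
import Data.List.Relation.Binary.Subset.Setoid.Properties as Subsetₚ
import Relation.Binary.Reasoning.Setoid as ≈-Reasoning

module _ {c ℓ : Level} (K : Field c ℓ) where
  open Field K
  open RingProperties ring using (x+x≈x⇒x≈0; +-cancelˡ)
  open MonoidProperties *-monoid using (cancelˡ)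
  open Membership setoid using (_∈_)
  open Subset setoid using (_⊆_)
  open ≈-Reasoning setoid

  *-almostCancelˡ : AlmostLeftCancellative _≈_ 0# _*_
  *-almostCancelˡ x y z x≉0 xy≈xz with inverse x x≉0
  ... | x⁻¹ , xx⁻¹≈1 = begin
    y              ≈⟨ cancelˡ x⁻¹x≈1 y ⟨
    x⁻¹ * (x * y)  ≈⟨ *-congˡ xy≈xz ⟩
    x⁻¹ * (x * z)  ≈⟨ cancelˡ x⁻¹x≈1 z ⟩
    z              ∎
    where
    x⁻¹x≈1 : x⁻¹ * x ≈ 1#
    x⁻¹x≈1 = trans (*-comm x⁻¹ x) xx⁻¹≈1

  ∈⇒∃-lookup : ∀ {r C} → r ∈ C → ∃ λ i → lookup C i ≈ r
  ∈⇒∃-lookup r∈C = index r∈C , sym (lookup-index r∈C)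

  Fixes : (C : List Carrier) → (Fin (length C) → Carrier) → Carrier → Set ℓ
  Fixes C f r = ∃ λ i → lookup C i ≈ r × f i ≈ r

  module _ {C : List Carrier} {f : Fin (length C) → Carrier}
           (admissible : Admissible K C f) where

    private
      unital : ∀ i → lookup C i ≈ 1# → f i ≈ 1#
      unital = proj₁ admissible

      additive : ∀ i j k → lookup C i + lookup C j ≈ lookup C k →
                 f k ≈ f i + f j
      additive = proj₁ (proj₂ admissible)

      multiplicative : ∀ i j k → lookup C i * lookup C j ≈ lookup C k →
                       f k ≈ f i * f j
      multiplicative = proj₂ (proj₂ admissible)

    fixes-0# : 0# ∈ C → Fixes C f 0#
    fixes-0# 0∈C with ∈⇒∃-lookup 0∈C
    ... | k , Ck≈0 = k , Ck≈0 , x+x≈x⇒x≈0 (f k) (sym (additive k k k (begin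
      lookup C k + lookup C k ≈⟨ +-cong Ck≈0 Ck≈0 ⟩
      0# + 0#                 ≈⟨ +-identityˡ 0# ⟩
      0#                      ≈⟨ Ck≈0 ⟨
      lookup C k              ∎)))

    fixes-1# : 1# ∈ C → Fixes C f 1#
    fixes-1# 1∈C with ∈⇒∃-lookup 1∈C
    ... | k , Ck≈1 = k , Ck≈1 , unital k Ck≈1

    fixes-+ : ∀ {x y} → Fixes C f x → Fixes C f y → x + y ∈ C → Fixes C f (x + y)
    fixes-+ {x} {y} (i , Ci≈x , fi≈x) (j , Cj≈y , fj≈y) x+y∈C
      with ∈⇒∃-lookup x+y∈C
    ... | k , Ck≈x+y = k , Ck≈x+y , (begin
      f k       ≈⟨ additive i j k (trans (+-cong Ci≈x Cj≈y) (sym Ck≈x+y)) ⟩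
      f i + f j ≈⟨ +-cong fi≈x fj≈y ⟩
      x + y     ∎)

    fixes-* : ∀ {x y} → Fixes C f x → Fixes C f y → x * y ∈ C → Fixes C f (x * y)
    fixes-* {x} {y} (i , Ci≈x , fi≈x) (j , Cj≈y , fj≈y) x*y∈C
      with ∈⇒∃-lookup x*y∈C
    ... | k , Ck≈x*y = k , Ck≈x*y , (begin
      f k       ≈⟨ multiplicative i j k (trans (*-cong Ci≈x Cj≈y) (sym Ck≈x*y)) ⟩
      f i * f j ≈⟨ *-cong fi≈x fj≈y ⟩
      x * y     ∎)

    fixes-+ʳ : ∀ {x y z} → Fixes C f x → Fixes C f z → x + y ≈ z → y ∈ C →
               Fixes C f y
    fixes-+ʳ {x} {y} {z} (i , Ci≈x , fi≈x) (k , Ck≈z , fk≈z) x+y≈z y∈C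
      with ∈⇒∃-lookup y∈C
    ... | j , Cj≈y = j , Cj≈y , +-cancelˡ x (f j) y (begin
      x + f j   ≈⟨ +-congʳ fi≈x ⟨
      f i + f j ≈⟨ additive i j k (trans (+-cong Ci≈x Cj≈y)
                                   (trans x+y≈z (sym Ck≈z))) ⟨
      f k       ≈⟨ fk≈z ⟩
      z         ≈⟨ x+y≈z ⟨
      x + y     ∎)

    fixes-*ʳ : ∀ {x y z} → ¬ x ≈ 0# → Fixes C f x → Fixes C f z → x * y ≈ z →
               y ∈ C → Fixes C f y
    fixes-*ʳ {x} {y} {z} x≉0 (i , Ci≈x , fi≈x) (k , Ck≈z , fk≈z) x*y≈z y∈C
      with ∈⇒∃-lookup y∈C
    ... | j , Cj≈y = j , Cj≈y , *-almostCancelˡ x (f j) y x≉0 (begin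
      x * f j   ≈⟨ *-congʳ fi≈x ⟨
      f i * f j ≈⟨ multiplicative i j k (trans (*-cong Ci≈x Cj≈y)
                                         (trans x*y≈z (sym Ck≈z))) ⟨
      f k       ≈⟨ fk≈z ⟩
      z         ≈⟨ x*y≈z ⟨
      x * y     ∎)

  adequate⇒fixes : ∀ {r C} → Adequate K r C →
                   (m : Map K C) → Admissible K C (proj₁ m) → Fixes C (proj₁ m) r
  adequate⇒fixes ((i , Ci≈r) , fixed) m adm = i , Ci≈r , fixed m adm i Ci≈r

  fixes⇒adequate : ∀ {r C} → r ∈ C →
                   ((m : Map K C) → Admissible K C (proj₁ m) → Fixes C (proj₁ m) r) →
                   Adequate K r C
  fixes⇒adequate r∈C fixes =
    ∈⇒∃-lookup r∈C , λ (f , f-wd) adm i Ci≈r →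
      let j , Cj≈r , fj≈r = fixes (f , f-wd) adm
      in trans (f-wd i j (trans Ci≈r (sym Cj≈r))) fj≈r

  module _ {A B : List Carrier} (A⊆B : A ⊆ B) where

    reindex : Fin (length A) → Fin (length B)
    reindex i = index (A⊆B (Membershipₚ.∈-lookup setoid A i))

    lookup-reindex : ∀ i → lookup A i ≈ lookup B (reindex i)
    lookup-reindex i = lookup-index (A⊆B (Membershipₚ.∈-lookup setoid A i))

    restrict : Map K B → Map K A
    restrict (f , f-wd) = f ∘ reindex , λ i j Ai≈Aj →
      f-wd _ _ (trans (sym (lookup-reindex i)) (trans Ai≈Aj (lookup-reindex j)))

    restrict-admissible : ∀ {f} → Admissible K B f → Admissible K A (f ∘ reindex)
    restrict-admissible (unital , additive , multiplicative) =
      (λ i Ai≈1 → unital _ (trans (sym (lookup-reindex i)) Ai≈1)) ,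
      (λ i j k e → additive _ _ _ (reindexed +-cong i j k e)) ,
      (λ i j k e → multiplicative _ _ _ (reindexed *-cong i j k e))
      where
      reindexed : ∀ {_∙_ : Carrier → Carrier → Carrier} →
                  (∀ {a b c d} → a ≈ b → c ≈ d → (a ∙ c) ≈ (b ∙ d)) →
                  ∀ i j k → (lookup A i ∙ lookup A j) ≈ lookup A k →
                  (lookup B (reindex i) ∙ lookup B (reindex j)) ≈ lookup B (reindex k)
      reindexed ∙-cong i j k e =
        trans (∙-cong (sym (lookup-reindex i)) (sym (lookup-reindex j)))
              (trans e (lookup-reindex k))

    adequate-⊆ : ∀ {r} → Adequate K r A → Adequate K r B
    adequate-⊆ ((i , Ai≈r) , fixed) =
      (reindex i , trans (sym (lookup-reindex i)) Ai≈r) , λ (f , f-wd) adm j Bj≈r →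
        trans (f-wd j (reindex i) (trans Bj≈r (trans (sym Ai≈r) (lookup-reindex i))))
              (fixed (restrict (f , f-wd)) (restrict-admissible adm) i Ai≈r)

  fixes-adequate : ∀ {r A C} → Adequate K r A → A ⊆ C →
                   (m : Map K C) → Admissible K C (proj₁ m) → Fixes C (proj₁ m) r
  fixes-adequate {C = C} adequate A⊆C =
    adequate⇒fixes {C = C} (adequate-⊆ A⊆C adequate)

  InKtilde-resp : ∀ {x y} → x ≈ y → InKtilde K x → InKtilde K y
  InKtilde-resp x≈y (A , (i , Ai≈x) , fixed) =
    A , (i , trans Ai≈x x≈y) , λ m adm j Aj≈y →
      trans (fixed m adm j (trans Aj≈y (sym x≈y))) x≈y

  InKtilde-0# : InKtilde K 0#
  InKtilde-0# = 0# ∷ [] , fixes⇒adequate (here refl) λ _ adm → fixes-0# adm (here refl)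

  InKtilde-1# : InKtilde K 1#
  InKtilde-1# = 1# ∷ [] , fixes⇒adequate (here refl) λ _ adm → fixes-1# adm (here refl)

  InKtilde-+ : ∀ {x y} → InKtilde K x → InKtilde K y → InKtilde K (x + y)
  InKtilde-+ {x} {y} (A , adequateA) (B , adequateB) =
    x + y ∷ A ++ B , fixes⇒adequate (here refl) λ m adm →
      fixes-+ adm (fixes-adequate adequateA (there ∘ Subsetₚ.xs⊆xs++ys setoid A B) m adm)
                  (fixes-adequate adequateB (there ∘ Subsetₚ.xs⊆ys++xs setoid B A) m adm)
                  (here refl)

  InKtilde-* : ∀ {x y} → InKtilde K x → InKtilde K y → InKtilde K (x * y)
  InKtilde-* {x} {y} (A , adequateA) (B , adequateB) =
    x * y ∷ A ++ B , fixes⇒adequate (here refl) λ m adm →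
      fixes-* adm (fixes-adequate adequateA (there ∘ Subsetₚ.xs⊆xs++ys setoid A B) m adm)
                  (fixes-adequate adequateB (there ∘ Subsetₚ.xs⊆ys++xs setoid B A) m adm)
                  (here refl)

  InKtilde-neg : ∀ {x} → InKtilde K x → InKtilde K (- x)
  InKtilde-neg {x} (A , adequateA) =
    - x ∷ 0# ∷ A , fixes⇒adequate (here refl) λ m adm →
      fixes-+ʳ adm (fixes-adequate adequateA (there ∘ there) m adm)
                   (fixes-0# adm (there (here refl)))
                   (-‿inverseʳ x) (here refl)

  InKtilde-inv : ∀ {x} → InKtilde K x → ¬ x ≈ 0# →
                 ∃ λ y → x * y ≈ 1# × InKtilde K y
  InKtilde-inv {x} (A , adequateA) x≉0 with inverse x x≉0
  ... | y , x*y≈1 = y , x*y≈1 ,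
    (y ∷ 1# ∷ A , fixes⇒adequate (here refl) λ m adm →
      fixes-*ʳ adm x≉0 (fixes-adequate adequateA (there ∘ there) m adm)
                       (fixes-1# adm (there (here refl)))
                       x*y≈1 (here refl))

theorem1 : ∀ {c ℓ : Level} (K : Field c ℓ) → IsSubfield K (InKtilde K)
theorem1 K = record
  { resp       = InKtilde-resp K
  ; has-0      = InKtilde-0# K
  ; has-1      = InKtilde-1# K
  ; +-closed   = InKtilde-+ K
  ; neg-closed = InKtilde-neg K
  ; *-closed   = InKtilde-* K
  ; inv-closed = InKtilde-inv K
  }
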